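{- Let $A=[A_1,\dots,A_n]$ be an $n\times n\times n$ alternating sign hypermatrix (ASHM) and $P=[P_1,\dots,P_n]$ an $n\times n\times n$ permutation hypermatrix. Then $L(A)\preceq_l L(P)$; that is, every row and every column of $L(A)=\sum_{k=1}^n kA_k$ is majorized by $z_n=(n,n-1,\dots,1)$.
   Context: An $n\times n$ alternating sign matrix (ASM) is a $(0,\pm1)$-matrix whose rows and columns each have nonzeros alternating in sign beginning and ending with $+1$. For an $n\times n\times n$ hypermatrix $A=[a_{ijk}]$, the horizontal planes are $A_k=[a_{ijk}]_{i,j}$, written $A=[A_1,\dots,A_n]$, and lines are obtained by fixing two indices and varying the third. $A$ is an ASHM if every line has nonzeros alternating in sign beginning and ending with $+1$; a permutation hypermatrix is a $(0,1)$-hypermatrix with exactly one $1$ in each line. For $L(A)=1A_1+\cdots+nA_n$. For vectors $x,y\in\mathbb R^n$, $x$ is majorized by $y$ ($x\preceq y$) if $\sum_{j=1}^k x_{[j]}\le\sum_{j=1}^k y_{[j]}$ for $k\le n$ with equality for $k=n$, where $x_{[j]}$ is the $j$th largest component of $x$. For $n\times n$ matrices, $A\preceq_l B$ means each row (column) of $A$ is majorized by the corresponding row (column) of $B$. Each row and column of $L(P)$ is a permutation of $(n,n-1,\dots,1)$. -}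

module Defs where

open import Data.Nat as ℕ using (ℕ)
open import Data.Integer as ℤ using (ℤ; +_; 0ℤ; 1ℤ; -1ℤ)
open import Data.Integer.Properties using (≤-decTotalOrder)
open import Data.Fin using (Fin; toℕ)
open import Data.List using (List; []; _∷_; filter; reverse; take; foldr)
open import Data.Vec.Functional using (Vector; toList)
open import Data.Product using (_×_)
open import Data.Sum using (_⊎_)
open import Relation.Binary.PropositionalEquality using (_≡_)
open import Relation.Nullary using (¬_; ¬?; yes; no)
open import Data.List.Sort ≤-decTotalOrder using (sort)

sumℤ : List ℤ → ℤ
sumℤ = foldr ℤ._+_ 0ℤ

Hypermatrix : ℕ → Set
Hypermatrix n = Fin n → Fin n → Fin n → ℤ

Matrix : ℕ → Set
Matrix n = Fin n → Fin n → ℤ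

data AltSigns : List ℤ → Set where
  alt-one  : AltSigns (1ℤ ∷ [])
  alt-cons : ∀ {xs} → AltSigns xs → AltSigns (1ℤ ∷ -1ℤ ∷ xs)

nonzeros : List ℤ → List ℤ
nonzeros = filter (λ x → ¬? (x ℤ.≟ 0ℤ))

AltSignLine : ∀ {n} → Vector ℤ n → Set
AltSignLine {n} v = (∀ i → v i ≡ 0ℤ ⊎ v i ≡ 1ℤ ⊎ v i ≡ -1ℤ) × AltSigns (nonzeros (toList v))

AllLines : ∀ {n} → (Vector ℤ n → Set) → Hypermatrix n → Set
AllLines P A =
  (∀ j k → P (λ i → A i j k)) ×
  (∀ i k → P (λ j → A i j k)) ×
  (∀ i j → P (λ k → A i j k))

IsASHM : ∀ {n} → Hypermatrix n → Set
IsASHM = AllLines AltSignLine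

count1 : List ℤ → ℕ
count1 [] = 0
count1 (x ∷ xs) with x ℤ.≟ 1ℤ
... | yes _ = ℕ.suc (count1 xs)
... | no _  = count1 xs

PermLine : ∀ {n} → Vector ℤ n → Set
PermLine v = (∀ i → v i ≡ 0ℤ ⊎ v i ≡ 1ℤ) × count1 (toList v) ≡ 1

IsPermutationHypermatrix : ∀ {n} → Hypermatrix n → Set
IsPermutationHypermatrix = AllLines PermLine

-- L(A) = 1·A₁ + ⋯ + n·Aₙ, with A_k the horizontal plane [a_{ijk}]_{i,j}
-- (k ranges over Fin n, so plane k has weight toℕ k + 1)
L : ∀ {n} → Hypermatrix n → Matrix n
L {n} A i j = sumℤ (toList (λ (k : Fin n) → + (ℕ.suc (toℕ k)) ℤ.* A i j k))

sortDesc : ∀ {n} → Vector ℤ n → List ℤ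
sortDesc v = reverse (sort (toList v))

topSum : ∀ {n} → ℕ → Vector ℤ n → ℤ
topSum k v = sumℤ (take k (sortDesc v))

_⪯_ : ∀ {n} → Vector ℤ n → Vector ℤ n → Set
_⪯_ {n} x y = (∀ k → k ℕ.≤ n → topSum k x ℤ.≤ topSum k y) × topSum n x ≡ topSum n y

_⪯ₗ_ : ∀ {n} → Matrix n → Matrix n → Set
A ⪯ₗ B = (∀ i → (λ j → A i j) ⪯ (λ j → B i j)) × (∀ j → (λ i → A i j) ⪯ (λ i → B i j))

-- Fix a row i of L(A) (columns are symmetric) and put B m k = a_{imk}.  By Abel
-- summation its entries are  x_m = Σ_k (k+1)·B m k = Σ_{t<n} τ_t(m)  where
-- τ_t(m) = Σ_{k≥t} B m k is a tail sum of the vertical line through (i,m).  Every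
-- tail sum of an alternating sign line is 0 or 1, and since each line in direction m
-- sums to 1 we get Σ_m τ_t(m) = n - t.  So for any k distinct indices m one has
-- Σ x_m ≤ Σ_{t<n} min(k, n-t), with equality when k = n.  For a permutation
-- hypermatrix the vertical lines are 0/1 vectors, so τ_t(m) = [t < y_m] where y_m is
-- the entry of L(P); the layer-cake formula for a non-increasing list of naturals
-- shows that the k largest y_m sum to exactly Σ_{t<n} min(k, n-t).
module Submission where

open import Defs
open import Data.Nat as ℕ using (ℕ; zero; suc; _∸_; _⊓_; z≤n; s≤s)
import Data.Nat.Properties as ℕP
open import Data.Nat.ListAction using (sum)
open import Data.Nat.ListAction.Properties using (sum-↭)
open import Data.Integer as ℤ using (ℤ; +_; 0ℤ; 1ℤ; -1ℤ; _+_; _*_; +≤+)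
import Data.Integer.Properties as ℤP
open import Algebra.Properties.CommutativeSemigroup ℤP.+-commutativeSemigroup
  using () renaming (interchange to +-interchange)
open import Data.Fin using (Fin; toℕ) renaming (zero to fzero; suc to fsuc)
open import Data.List using (List; []; _∷_; _++_; map; take; drop; reverse; length; tabulate; allFin)
import Data.List.Properties as LP
open import Data.List.Relation.Unary.All as All using (All; []; _∷_)
import Data.List.Relation.Unary.All.Properties as AllP
open import Data.List.Relation.Unary.AllPairs as AllPairs using (AllPairs; []; _∷_)
import Data.List.Relation.Unary.AllPairs.Properties as AllPairsP
open import Data.List.Relation.Unary.Linked.Properties using (Linked⇒AllPairs)
open import Data.List.Relation.Binary.Permutation.Propositional using (_↭_; ↭-sym; ↭-trans; ↭⇒↭ₛ)
import Data.List.Relation.Binary.Permutation.Propositional.Properties as ↭P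
open import Data.List.Sort ℤP.≤-decTotalOrder using (sort; sort-↭; sort-↗)
open import Data.Product using (Σ; _×_; _,_; proj₁; proj₂)
open import Data.Sum using (_⊎_; inj₁; inj₂)
open import Data.Empty using (⊥-elim)
open import Function using (_∘_; flip)
open import Relation.Nullary using (yes; no)
open import Relation.Binary.PropositionalEquality as ≡
  using (_≡_; _≢_; refl; sym; trans; cong; cong₂; subst)
open import Data.List.Relation.Binary.Permutation.Setoid.Properties (≡.setoid ℤ)
  using (foldr-commMonoid)

∑ : ℕ → (ℕ → ℤ) → ℤ
∑ zero    f = 0ℤ
∑ (suc n) f = f 0 + ∑ n (f ∘ suc)

∑-cong : ∀ n {f g : ℕ → ℤ} → (∀ t → f t ≡ g t) → ∑ n f ≡ ∑ n g
∑-cong zero    f≡g = refl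
∑-cong (suc n) f≡g = cong₂ _+_ (f≡g 0) (∑-cong n (f≡g ∘ suc))

∑-mono : ∀ n {f g : ℕ → ℤ} → (∀ t → f t ℤ.≤ g t) → ∑ n f ℤ.≤ ∑ n g
∑-mono zero    f≤g = ℤP.≤-refl
∑-mono (suc n) f≤g = ℤP.+-mono-≤ (f≤g 0) (∑-mono n (f≤g ∘ suc))

∑-zero : ∀ n → ∑ n (λ _ → 0ℤ) ≡ 0ℤ
∑-zero zero    = refl
∑-zero (suc n) = trans (ℤP.+-identityˡ _) (∑-zero n)

∑-+ : ∀ n (f g : ℕ → ℤ) → ∑ n (λ t → f t + g t) ≡ ∑ n f + ∑ n g
∑-+ zero    f g = refl
∑-+ (suc n) f g = trans (cong (_+_ (f 0 + g 0)) (∑-+ n (f ∘ suc) (g ∘ suc)))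
                        (+-interchange (f 0) (g 0) _ _)

sumℤ-++ : ∀ xs ys → sumℤ (xs ++ ys) ≡ sumℤ xs + sumℤ ys
sumℤ-++ []       ys = sym (ℤP.+-identityˡ _)
sumℤ-++ (x ∷ xs) ys = trans (cong (_+_ x) (sumℤ-++ xs ys)) (sym (ℤP.+-assoc x _ _))

sumℤ-↭ : ∀ {xs ys} → xs ↭ ys → sumℤ xs ≡ sumℤ ys
sumℤ-↭ p = foldr-commMonoid ℤP.+-0-isCommutativeMonoid (↭⇒↭ₛ p)

+-sum : ∀ ns → + sum ns ≡ sumℤ (map +_ ns)
+-sum []       = refl
+-sum (a ∷ ns) = trans (ℤP.pos-+ a (sum ns)) (cong (_+_ (+ a)) (+-sum ns))

sum-∑ : ∀ {A : Set} n (g : A → ℕ → ℤ) Z →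
        sumℤ (map (λ m → ∑ n (g m)) Z) ≡ ∑ n (λ t → sumℤ (map (λ m → g m t) Z))
sum-∑ n g []      = sym (∑-zero n)
sum-∑ n g (z ∷ Z) = trans (cong (_+_ (∑ n (g z))) (sum-∑ n g Z)) (sym (∑-+ n (g z) _))

sum-tabulate-zero : ∀ n → sumℤ (tabulate {n = n} (λ _ → 0ℤ)) ≡ 0ℤ
sum-tabulate-zero zero    = refl
sum-tabulate-zero (suc n) = trans (ℤP.+-identityˡ _) (sum-tabulate-zero n)

sum-tabulate-+ : ∀ {n} (f g : Fin n → ℤ) →
                 sumℤ (tabulate (λ k → f k + g k)) ≡ sumℤ (tabulate f) + sumℤ (tabulate g)
sum-tabulate-+ {zero}  f g = refl
sum-tabulate-+ {suc n} f g = trans (cong (_+_ (f fzero + g fzero)) (sum-tabulate-+ (f ∘ fsuc) (g ∘ fsuc)))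
                                   (+-interchange (f fzero) (g fzero) _ _)

sum-tabulate-* : ∀ {n} c (f : Fin n → ℤ) → sumℤ (tabulate (λ k → c * f k)) ≡ c * sumℤ (tabulate f)
sum-tabulate-* {zero}  c f = sym (ℤP.*-zeroʳ c)
sum-tabulate-* {suc n} c f = trans (cong (_+_ (c * f fzero)) (sum-tabulate-* c (f ∘ fsuc)))
                                   (sym (ℤP.*-distribˡ-+ c (f fzero) _))

sum-tabulate-swap : ∀ {m n} (h : Fin m → Fin n → ℤ) →
  sumℤ (tabulate (λ i → sumℤ (tabulate (h i)))) ≡ sumℤ (tabulate (λ j → sumℤ (tabulate (λ i → h i j))))
sum-tabulate-swap {zero}  {n} h = sym (sum-tabulate-zero n)
sum-tabulate-swap {suc m}     h = trans (cong (_+_ (sumℤ (tabulate (h fzero)))) (sum-tabulate-swap (h ∘ fsuc)))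
                                        (sym (sum-tabulate-+ (h fzero) _))

weighted : ∀ {n} → (Fin n → ℤ) → ℤ
weighted v = sumℤ (tabulate (λ k → + suc (toℕ k) * v k))

tail : ℕ → List ℤ → ℤ
tail t ℓ = sumℤ (drop t ℓ)

weighted-shift : ∀ {n} (v : Fin n → ℤ) →
  sumℤ (tabulate (λ k → + suc (suc (toℕ k)) * v k)) ≡ sumℤ (tabulate v) + weighted v
weighted-shift v = trans (cong sumℤ (LP.tabulate-cong (λ k → ℤP.suc-* (+ suc (toℕ k)) (v k))))
                         (sum-tabulate-+ v _)

abel : ∀ {n} (v : Fin n → ℤ) → weighted v ≡ ∑ n (λ t → tail t (tabulate v))
abel {zero}  v = refl
abel {suc n} v = begin
  1ℤ * v fzero + sumℤ (tabulate (λ k → + suc (suc (toℕ k)) * v (fsuc k)))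
    ≡⟨ cong₂ _+_ (ℤP.*-identityˡ (v fzero)) (weighted-shift (v ∘ fsuc)) ⟩
  v fzero + (sumℤ (tabulate (v ∘ fsuc)) + weighted (v ∘ fsuc))
    ≡⟨ cong (λ w → v fzero + (sumℤ (tabulate (v ∘ fsuc)) + w)) (abel (v ∘ fsuc)) ⟩
  v fzero + (sumℤ (tabulate (v ∘ fsuc)) + ∑ n (λ t → tail t (tabulate (v ∘ fsuc))))
    ≡⟨ sym (ℤP.+-assoc (v fzero) _ _) ⟩
  ∑ (suc n) (λ t → tail t (tabulate v)) ∎
  where open ≡.≡-Reasoning

𝟙[_<_] : ℕ → ℕ → ℕ
𝟙[ t     < zero  ] = 0
𝟙[ zero  < suc a ] = 1
𝟙[ suc t < suc a ] = 𝟙[ t < a ]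

𝟙-< : ∀ {t a} → t ℕ.< a → 𝟙[ t < a ] ≡ 1
𝟙-< {zero}  (s≤s _)   = refl
𝟙-< {suc t} (s≤s t<a) = 𝟙-< t<a

𝟙-≥ : ∀ {t a} → a ℕ.≤ t → 𝟙[ t < a ] ≡ 0
𝟙-≥ z≤n       = refl
𝟙-≥ (s≤s a≤t) = 𝟙-≥ a≤t

∑-𝟙 : ∀ {n a} → a ℕ.≤ n → ∑ n (λ t → + 𝟙[ t < a ]) ≡ + a
∑-𝟙 {n}     {zero}  _         = ∑-zero n
∑-𝟙 {suc n} {suc a} (s≤s a≤n) = cong (_+_ 1ℤ) (∑-𝟙 a≤n)

tail-indicator : ∀ {n} t (v : Fin n → ℤ) →
  tail t (tabulate v) ≡ sumℤ (tabulate (λ k → + 𝟙[ t < suc (toℕ k) ] * v k))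
tail-indicator {zero}  zero    v = refl
tail-indicator {zero}  (suc t) v = refl
tail-indicator {suc n} zero    v = cong sumℤ (LP.tabulate-cong (λ k → sym (ℤP.*-identityˡ (v k))))
tail-indicator {suc n} (suc t) v = trans (tail-indicator t (v ∘ fsuc)) (sym (ℤP.+-identityˡ _))

sum-indicator : ∀ n t → sumℤ (tabulate {n = n} (λ k → + 𝟙[ t < suc (toℕ k) ])) ≡ + (n ∸ t)
sum-indicator zero    t       = cong +_ (sym (ℕP.0∸n≡0 t))
sum-indicator (suc n) zero    = cong (_+_ 1ℤ) (sum-indicator n 0)
sum-indicator (suc n) (suc t) = trans (ℤP.+-identityˡ _) (sum-indicator n t)

tail-columns : ∀ {n} (B : Matrix n) → (∀ k → sumℤ (tabulate (λ m → B m k)) ≡ 1ℤ) →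
  ∀ t → sumℤ (tabulate (λ m → tail t (tabulate (B m)))) ≡ + (n ∸ t)
tail-columns {n} B colSums t = begin
  sumℤ (tabulate (λ m → tail t (tabulate (B m))))
    ≡⟨ cong sumℤ (LP.tabulate-cong (λ m → tail-indicator t (B m))) ⟩
  sumℤ (tabulate (λ m → sumℤ (tabulate (λ k → χ k * B m k))))
    ≡⟨ sum-tabulate-swap (λ m k → χ k * B m k) ⟩
  sumℤ (tabulate (λ k → sumℤ (tabulate (λ m → χ k * B m k))))
    ≡⟨ cong sumℤ (LP.tabulate-cong column) ⟩
  sumℤ (tabulate χ)
    ≡⟨ sum-indicator n t ⟩
  + (n ∸ t) ∎
  where
    open ≡.≡-Reasoning
    χ : Fin n → ℤ
    χ k = + 𝟙[ t < suc (toℕ k) ]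
    column : ∀ k → sumℤ (tabulate (λ m → χ k * B m k)) ≡ χ k
    column k = begin
      sumℤ (tabulate (λ m → χ k * B m k)) ≡⟨ sum-tabulate-* (χ k) (λ m → B m k) ⟩
      χ k * sumℤ (tabulate (λ m → B m k)) ≡⟨ cong (χ k *_) (colSums k) ⟩
      χ k * 1ℤ                            ≡⟨ ℤP.*-identityʳ (χ k) ⟩
      χ k                                 ∎

Bit : ℤ → Set
Bit z = z ≡ 0ℤ ⊎ z ≡ 1ℤ

sumℤ-nonzeros : ∀ ℓ → sumℤ (nonzeros ℓ) ≡ sumℤ ℓ
sumℤ-nonzeros []      = refl
sumℤ-nonzeros (x ∷ ℓ) with x ℤ.≟ 0ℤ
... | yes refl = trans (sumℤ-nonzeros ℓ) (sym (ℤP.+-identityˡ _))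
... | no _     = cong (_+_ x) (sumℤ-nonzeros ℓ)

altSigns-sum : ∀ {ys} → AltSigns ys → sumℤ ys ≡ 1ℤ
altSigns-sum alt-one                                 = refl
altSigns-sum (alt-cons alt) rewrite altSigns-sum alt = refl

-- Suffixes of alternating sign sequences +1, -1, +1, …, +1: they are empty, or again
-- alternating, or alternating after a leading -1.  Their sums are 0 or 1.
data AltSuffix : List ℤ → Set where
  empty     : AltSuffix []
  full      : ∀ {ys} → AltSigns ys → AltSuffix ys
  afterPlus : ∀ {ys} → AltSigns ys → AltSuffix (-1ℤ ∷ ys)

altSuffix-tail : ∀ {x ys} → AltSuffix (x ∷ ys) → AltSuffix ys
altSuffix-tail (full alt-one)         = empty
altSuffix-tail (full (alt-cons alt))  = afterPlus alt
altSuffix-tail (afterPlus alt)        = full alt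

altSuffix-drop : ∀ t ℓ → AltSuffix (nonzeros ℓ) → AltSuffix (nonzeros (drop t ℓ))
altSuffix-drop zero    ℓ       s = s
altSuffix-drop (suc t) []      s = s
altSuffix-drop (suc t) (x ∷ ℓ) s with x ℤ.≟ 0ℤ
... | yes _ = altSuffix-drop t ℓ s
... | no  _ = altSuffix-drop t ℓ (altSuffix-tail s)

altSuffix-sum : ∀ {ys} → AltSuffix ys → Bit (sumℤ ys)
altSuffix-sum empty           = inj₁ refl
altSuffix-sum (full alt)      = inj₂ (altSigns-sum alt)
altSuffix-sum (afterPlus alt) rewrite altSigns-sum alt = inj₁ refl

alt-tails : ∀ {n} {v : Fin n → ℤ} → AltSignLine v → ∀ t → Bit (tail t (tabulate v))
alt-tails {v = v} (_ , alt) t =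
  subst Bit (sumℤ-nonzeros (drop t (tabulate v))) (altSuffix-sum (altSuffix-drop t (tabulate v) (full alt)))

alt-sum : ∀ {n} {v : Fin n → ℤ} → AltSignLine v → sumℤ (tabulate v) ≡ 1ℤ
alt-sum {v = v} (_ , alt) = trans (sym (sumℤ-nonzeros (tabulate v))) (altSigns-sum alt)

sum-bits : ∀ {ℓ} → All Bit ℓ → sumℤ ℓ ≡ + count1 ℓ
sum-bits []                = refl
sum-bits (inj₁ refl ∷ bits) = trans (ℤP.+-identityˡ _) (sum-bits bits)
sum-bits (inj₂ refl ∷ bits) rewrite sum-bits bits = refl

count1-drop : ∀ t ℓ → count1 (drop t ℓ) ℕ.≤ count1 ℓ
count1-drop zero    ℓ       = ℕP.≤-refl
count1-drop (suc t) []      = ℕP.≤-refl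
count1-drop (suc t) (x ∷ ℓ) with x ℤ.≟ 1ℤ
... | yes _ = ℕP.m≤n⇒m≤1+n (count1-drop t ℓ)
... | no  _ = count1-drop t ℓ

bit-≤1 : ∀ {c} → c ℕ.≤ 1 → Bit (+ c)
bit-≤1 z≤n       = inj₁ refl
bit-≤1 (s≤s z≤n) = inj₂ refl

perm-tails : ∀ {n} {v : Fin n → ℤ} → PermLine v → ∀ t → Bit (tail t (tabulate v))
perm-tails {v = v} (bits , one) t =
  subst Bit (sym (sum-bits (AllP.drop⁺ t (AllP.tabulate⁺ bits))))
    (bit-≤1 (subst (count1 (drop t (tabulate v)) ℕ.≤_) one (count1-drop t (tabulate v))))

perm-sum : ∀ {n} {v : Fin n → ℤ} → PermLine v → sumℤ (tabulate v) ≡ 1ℤ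
perm-sum (bits , one) = trans (sum-bits (AllP.tabulate⁺ bits)) (cong +_ one)

perm-nonneg : ∀ {n} {v : Fin n → ℤ} → PermLine v → ∀ k → 0ℤ ℤ.≤ v k
perm-nonneg (bits , _) k = bit-nonneg (bits k)
  where
    bit-nonneg : ∀ {z} → Bit z → 0ℤ ℤ.≤ z
    bit-nonneg (inj₁ refl) = +≤+ z≤n
    bit-nonneg (inj₂ refl) = +≤+ z≤n

-- A square matrix whose rows have all tail sums 0 or 1 and whose columns sum to 1.
-- Typically B is the plane of A through a fixed row (or column) of L(A): row m of B is
-- the vertical line through position m, and column k of B lies in the plane A_k.
record BitTailPlane {n : ℕ} (B : Matrix n) : Set where
  field
    rowTails : ∀ m t → Bit (tail t (tabulate (B m)))
    colSums  : ∀ k → sumℤ (tabulate (λ m → B m k)) ≡ 1ℤ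

altPlane : ∀ {n} {B : Matrix n} → (∀ m → AltSignLine (B m)) →
           (∀ k → AltSignLine (λ m → B m k)) → BitTailPlane B
altPlane rows cols = record { rowTails = λ m → alt-tails (rows m) ; colSums = λ k → alt-sum (cols k) }

permPlane : ∀ {n} {B : Matrix n} → (∀ m → PermLine (B m)) →
            (∀ k → PermLine (λ m → B m k)) → BitTailPlane B
permPlane rows cols = record { rowTails = λ m → perm-tails (rows m) ; colSums = λ k → perm-sum (cols k) }

rowWeights : ∀ {n} → Matrix n → Fin n → ℤ
rowWeights B m = weighted (B m)

-- Σ_{t<n} min(k, n-t), the sum of the k largest entries of (n, n-1, …, 1).
topBound : ℕ → ℕ → ℤ
topBound n k = ∑ n (λ t → + (k ⊓ (n ∸ t)))

sum-of-bits : ∀ {A : Set} (g : A → ℤ) → (∀ m → Bit (g m)) → ∀ Z →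
              Σ ℕ λ c → sumℤ (map g Z) ≡ + c × c ℕ.≤ length Z
sum-of-bits g bits []      = 0 , refl , z≤n
sum-of-bits g bits (z ∷ Z) with sum-of-bits g bits Z | bits z
... | c , sum≡c , c≤ | inj₁ gz≡0 = c , trans (cong₂ _+_ gz≡0 sum≡c) (ℤP.+-identityˡ _) , ℕP.m≤n⇒m≤1+n c≤
... | c , sum≡c , c≤ | inj₂ gz≡1 = suc c , cong₂ _+_ gz≡1 sum≡c , s≤s c≤

sortDesc-↭ : ∀ {n} (x : Fin n → ℤ) → sortDesc x ↭ tabulate x
sortDesc-↭ x = ↭-trans (↭P.↭-reverse (sort (tabulate x))) (sort-↭ (tabulate x))

topSum-prefix : ∀ {n} (x : Fin n → ℤ) →
  Σ (List (Fin n)) λ zs → allFin n ↭ zs × (∀ k → topSum k x ≡ sumℤ (map x (take k zs)))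
topSum-prefix {n} x with ↭P.↭-map-inv x (subst (_↭ sortDesc x) (sym (LP.map-tabulate (λ i → i) x))
                                            (↭-sym (sortDesc-↭ x)))
... | zs , sortDesc≡ , allFin↭zs =
  zs , allFin↭zs , λ k → cong sumℤ (trans (cong (take k) sortDesc≡) (LP.take-map k zs))

length-enumeration : ∀ {n} {zs : List (Fin n)} → allFin n ↭ zs → length zs ≡ n
length-enumeration {n} allFin↭zs = trans (sym (↭P.↭-length allFin↭zs)) (LP.length-tabulate {n = n} (λ i → i))

module _ {n : ℕ} {B : Matrix n} (plane : BitTailPlane B) where
  open BitTailPlane plane

  private
    τ : ℕ → Fin n → ℤ
    τ t m = tail t (tabulate (B m))

  sum-rows : ∀ Z → sumℤ (map (rowWeights B) Z) ≡ ∑ n (λ t → sumℤ (map (τ t) Z))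
  sum-rows Z = trans (cong sumℤ (LP.map-cong (λ m → abel (B m)) Z)) (sum-∑ n (λ m t → τ t m) Z)

  layer-total : ∀ t → sumℤ (map (τ t) (allFin n)) ≡ + (n ∸ t)
  layer-total t = trans (cong sumℤ (LP.map-tabulate (λ i → i) (τ t))) (tail-columns B colSums t)

  layer-bound : ∀ Z W → Z ++ W ↭ allFin n → ∀ t → sumℤ (map (τ t) Z) ℤ.≤ + (length Z ⊓ (n ∸ t))
  layer-bound Z W Z++W↭ t
    with sum-of-bits (τ t) (λ m → rowTails m t) Z | sum-of-bits (τ t) (λ m → rowTails m t) W
  ... | c , sumZ≡c , c≤|Z| | d , sumW≡d , _ =
    ℤP.≤-trans (ℤP.≤-reflexive sumZ≡c) (+≤+ (ℕP.⊓-glb c≤|Z| (subst (c ℕ.≤_) c+d≡ (ℕP.m≤m+n c d))))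
    where
      open ≡.≡-Reasoning
      c+d≡ : c ℕ.+ d ≡ n ∸ t
      c+d≡ = ℤP.+-injective (begin
        + c + + d                               ≡⟨ cong₂ _+_ sumZ≡c sumW≡d ⟨
        sumℤ (map (τ t) Z) + sumℤ (map (τ t) W) ≡⟨ sumℤ-++ (map (τ t) Z) _ ⟨
        sumℤ (map (τ t) Z ++ map (τ t) W)       ≡⟨ cong sumℤ (LP.map-++ (τ t) Z W) ⟨
        sumℤ (map (τ t) (Z ++ W))               ≡⟨ sumℤ-↭ (↭P.map⁺ (τ t) Z++W↭) ⟩
        sumℤ (map (τ t) (allFin n))             ≡⟨ layer-total t ⟩
        + (n ∸ t)                               ∎)

  -- The k largest entries of the row of L are k distinct entries, so they obey the bound.
  topSum-≤ : ∀ k → k ℕ.≤ n → topSum k (rowWeights B) ℤ.≤ topBound n k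
  topSum-≤ k k≤n with topSum-prefix (rowWeights B)
  ... | zs , allFin↭zs , topSum≡ = begin
    topSum k (rowWeights B)                   ≡⟨ topSum≡ k ⟩
    sumℤ (map (rowWeights B) (take k zs))     ≡⟨ sum-rows (take k zs) ⟩
    ∑ n (λ t → sumℤ (map (τ t) (take k zs)))  ≤⟨ ∑-mono n (layer-bound (take k zs) (drop k zs) split) ⟩
    topBound n (length (take k zs))           ≡⟨ cong (topBound n) length-take ⟩
    topBound n k                              ∎
    where
      open ℤP.≤-Reasoning
      split : take k zs ++ drop k zs ↭ allFin n
      split = subst (_↭ allFin n) (sym (LP.take++drop≡id k zs)) (↭-sym allFin↭zs)
      length-take : length (take k zs) ≡ k
      length-take = trans (LP.length-take k zs)
        (trans (cong (k ⊓_) (length-enumeration allFin↭zs)) (ℕP.m≤n⇒m⊓n≡m k≤n))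

  topSum-total : topSum n (rowWeights B) ≡ ∑ n (λ t → + (n ∸ t))
  topSum-total with topSum-prefix (rowWeights B)
  ... | zs , allFin↭zs , topSum≡ = begin
    topSum n (rowWeights B)                ≡⟨ topSum≡ n ⟩
    sumℤ (map (rowWeights B) (take n zs))  ≡⟨ cong (sumℤ ∘ map (rowWeights B)) take-all ⟩
    sumℤ (map (rowWeights B) zs)           ≡⟨ sumℤ-↭ (↭P.map⁺ (rowWeights B) (↭-sym allFin↭zs)) ⟩
    sumℤ (map (rowWeights B) (allFin n))   ≡⟨ sum-rows (allFin n) ⟩
    ∑ n (λ t → sumℤ (map (τ t) (allFin n))) ≡⟨ ∑-cong n layer-total ⟩
    ∑ n (λ t → + (n ∸ t))                  ∎
    where
      open ≡.≡-Reasoning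
      take-all : take n zs ≡ zs
      take-all = LP.take-all n zs (ℕP.≤-reflexive (length-enumeration allFin↭zs))

count : ℕ → List ℕ → ℕ
count t ns = sum (map (λ a → 𝟙[ t < a ]) ns)

count-below : ∀ {t ns} → All (ℕ._≤ t) ns → count t ns ≡ 0
count-below []             = refl
count-below (a≤t ∷ ns≤t) rewrite 𝟙-≥ a≤t = count-below ns≤t

layer-cake : ∀ n ns → AllPairs ℕ._≥_ ns → All (ℕ._≤ n) ns → ∀ k →
             sumℤ (take k (map +_ ns)) ≡ ∑ n (λ t → + (k ⊓ count t ns))
layer-cake n []       _ _ zero    = sym (∑-zero n)
layer-cake n []       _ _ (suc k) = sym (∑-zero n)
layer-cake n (a ∷ ns) _ _ zero    = sym (∑-zero n)
layer-cake n (a ∷ ns) (ns≤a ∷ desc) (a≤n ∷ bounded) (suc k) = begin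
  + a + sumℤ (take k (map +_ ns))
    ≡⟨ cong₂ _+_ (sym (∑-𝟙 a≤n)) (layer-cake n ns desc bounded k) ⟩
  ∑ n (λ t → + 𝟙[ t < a ]) + ∑ n (λ t → + (k ⊓ count t ns))
    ≡⟨ ∑-+ n _ _ ⟨
  ∑ n (λ t → + 𝟙[ t < a ] + + (k ⊓ count t ns))
    ≡⟨ ∑-cong n layer ⟩
  ∑ n (λ t → + (suc k ⊓ count t (a ∷ ns))) ∎
  where
    open ≡.≡-Reasoning
    -- in a layer t < a the entry a counts once; in a layer t ≥ a so does no later entry
    layer : ∀ t → + 𝟙[ t < a ] + + (k ⊓ count t ns) ≡ + (suc k ⊓ (𝟙[ t < a ] ℕ.+ count t ns))
    layer t with t ℕ.<? a
    ... | yes t<a rewrite 𝟙-< t<a = refl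
    ... | no  t≮a rewrite 𝟙-≥ (ℕP.≮⇒≥ t≮a)
                        | count-below (All.map (λ b≤a → ℕP.≤-trans b≤a (ℕP.≮⇒≥ t≮a)) ns≤a)
                        | ℕP.⊓-zeroʳ k = refl

reverse-AllPairs : ∀ {A : Set} {R : A → A → Set} {xs} → AllPairs R xs → AllPairs (flip R) (reverse xs)
reverse-AllPairs []                    = []
reverse-AllPairs {R = R} {x ∷ xs} (x≤xs ∷ sorted) =
  subst (AllPairs (flip R)) (sym (LP.unfold-reverse x xs))
    (AllPairsP.++⁺ (reverse-AllPairs sorted) ([] ∷ [])
                   (All.map (_∷ []) (↭P.All-resp-↭ (↭-sym (↭P.↭-reverse xs)) x≤xs)))

sortDesc-descending : ∀ {n} (x : Fin n → ℤ) → AllPairs ℤ._≥_ (sortDesc x)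
sortDesc-descending x = reverse-AllPairs (Linked⇒AllPairs ℤP.≤-trans (sort-↗ (tabulate x)))

-- x + 1 ≠ 0 for x ≥ 0: a nonnegative entry cannot precede a 1 by a tail sum 0.
nonneg+1≢0 : ∀ {x} → 0ℤ ℤ.≤ x → x + 1ℤ ≢ 0ℤ
nonneg+1≢0 (+≤+ {n = zero}  _) ()
nonneg+1≢0 (+≤+ {n = suc _} _) ()

step-tails : ∀ ℓ → (∀ t → Bit (tail t ℓ)) → All (0ℤ ℤ.≤_) ℓ →
             Σ ℕ λ a → a ℕ.≤ length ℓ × (∀ t → tail t ℓ ≡ + 𝟙[ t < a ])
step-tails []      _    _ = 0 , z≤n , λ { zero → refl ; (suc t) → refl }
step-tails (x ∷ ℓ) bits (x≥0 ∷ ℓ≥0) with step-tails ℓ (bits ∘ suc) ℓ≥0 | bits 0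
... | b     , b≤ , tails | inj₂ τ₀≡1 = suc b , s≤s b≤ , λ { zero → τ₀≡1 ; (suc t) → tails t }
... | zero  , _  , tails | inj₁ τ₀≡0 = 0 , z≤n , λ { zero → τ₀≡0 ; (suc t) → tails t }
... | suc b , _  , tails | inj₁ τ₀≡0 = ⊥-elim (nonneg+1≢0 x≥0 (trans (cong (_+_ x) (sym (tails 0))) τ₀≡0))

module _ {n : ℕ} {C : Matrix n} (plane : BitTailPlane C) (nonneg : ∀ m k → 0ℤ ℤ.≤ C m k) where
  open BitTailPlane plane

  private
    step : ∀ m → Σ ℕ λ a → a ℕ.≤ length (tabulate (C m)) × (∀ t → tail t (tabulate (C m)) ≡ + 𝟙[ t < a ])
    step m = step-tails (tabulate (C m)) (rowTails m) (AllP.tabulate⁺ (nonneg m))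

  -- h m is the number of layers in which row m has tail sum 1.
  height : Fin n → ℕ
  height m = proj₁ (step m)

  height-≤ : ∀ m → height m ℕ.≤ n
  height-≤ m = subst (height m ℕ.≤_) (LP.length-tabulate (C m)) (proj₁ (proj₂ (step m)))

  weight≡height : ∀ m → rowWeights C m ≡ + height m
  weight≡height m = trans (abel (C m)) (trans (∑-cong n (proj₂ (proj₂ (step m)))) (∑-𝟙 (height-≤ m)))

  count-heights : ∀ t → count t (tabulate height) ≡ n ∸ t
  count-heights t = ℤP.+-injective (begin
    + count t (tabulate height)                       ≡⟨ +-sum (map (λ a → 𝟙[ t < a ]) (tabulate height)) ⟩
    sumℤ (map +_ (map (λ a → 𝟙[ t < a ]) (tabulate height)))
      ≡⟨ cong sumℤ (trans (cong (map (+_)) (LP.map-tabulate height _)) (LP.map-tabulate _ (+_))) ⟩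
    sumℤ (tabulate (λ m → + 𝟙[ t < height m ]))       ≡⟨ cong sumℤ (LP.tabulate-cong (λ m → sym (proj₂ (proj₂ (step m)) t))) ⟩
    sumℤ (tabulate (λ m → tail t (tabulate (C m))))   ≡⟨ tail-columns C colSums t ⟩
    + (n ∸ t)                                         ∎)
    where open ≡.≡-Reasoning

  topSum-exact : ∀ k → topSum k (rowWeights C) ≡ topBound n k
  topSum-exact k with ↭P.↭-map-inv (+_) heights↭sortDesc
    where
      heights↭sortDesc : map +_ (tabulate height) ↭ sortDesc (rowWeights C)
      heights↭sortDesc = subst (_↭ sortDesc (rowWeights C))
        (trans (LP.tabulate-cong weight≡height) (sym (LP.map-tabulate height (+_))))
        (↭-sym (sortDesc-↭ (rowWeights C)))
  ... | ns , sortDesc≡ , heights↭ns = begin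
    sumℤ (take k (sortDesc (rowWeights C)))  ≡⟨ cong (sumℤ ∘ take k) sortDesc≡ ⟩
    sumℤ (take k (map +_ ns))                ≡⟨ layer-cake n ns descending bounded k ⟩
    ∑ n (λ t → + (k ⊓ count t ns))           ≡⟨ ∑-cong n (λ t → cong (λ c → + (k ⊓ c)) (count≡ t)) ⟩
    topBound n k                             ∎
    where
      open ≡.≡-Reasoning
      descending : AllPairs ℕ._≥_ ns
      descending = AllPairs.map ℤP.drop‿+≤+
        (AllPairsP.map⁻ (subst (AllPairs ℤ._≥_) sortDesc≡ (sortDesc-descending (rowWeights C))))
      bounded : All (ℕ._≤ n) ns
      bounded = ↭P.All-resp-↭ heights↭ns (AllP.tabulate⁺ height-≤)
      count≡ : ∀ t → count t ns ≡ n ∸ t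
      count≡ t = trans (sym (sum-↭ (↭P.map⁺ (λ a → 𝟙[ t < a ]) heights↭ns))) (count-heights t)

plane-majorization : ∀ {n} {B C : Matrix n} → BitTailPlane B → BitTailPlane C →
                     (∀ m k → 0ℤ ℤ.≤ C m k) → rowWeights B ⪯ rowWeights C
plane-majorization B-plane C-plane nonneg =
  (λ k k≤n → ℤP.≤-trans (topSum-≤ B-plane k k≤n) (ℤP.≤-reflexive (sym (topSum-exact C-plane nonneg k)))) ,
  trans (topSum-total B-plane) (sym (topSum-total C-plane))

theorem3p3 : (n : ℕ) (A P : Hypermatrix n) → IsASHM A → IsPermutationHypermatrix P → L A ⪯ₗ L P
theorem3p3 n A P (aⱼ , aᵢ , aₖ) (pⱼ , pᵢ , pₖ) = rows , columns
  where
    -- row i of L(A) comes from the plane B m k = a_{imk}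
    rows : ∀ i → (λ j → L A i j) ⪯ (λ j → L P i j)
    rows i = plane-majorization (altPlane (aₖ i) (aᵢ i)) (permPlane (pₖ i) (pᵢ i))
                                (λ m → perm-nonneg (pₖ i m))
    -- column j of L(A) comes from the plane B m k = a_{mjk}
    columns : ∀ j → (λ i → L A i j) ⪯ (λ i → L P i j)
    columns j = plane-majorization (altPlane (λ m → aₖ m j) (aⱼ j)) (permPlane (λ m → pₖ m j) (pⱼ j))
                                   (λ m → perm-nonneg (pₖ m j))
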